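{- If $\mathfrak{A}=\langle A,\sqcap,-,0,f\rangle$ is an additive (but not necessarily normal) Boolean frame, then $\mathfrak{A}$ has the congruence extension property.
   Context: A Boolean frame is an algebra $\langle A,\sqcap,-,0,f\rangle$ with $\langle A,\sqcap,-,0\rangle$ a Boolean algebra and $f:A\to A$ an arbitrary unary operation; it is additive if $f(x\sqcup y)=f(x)\sqcup f(y)$ for all $x,y$, and normal if $f(0)=0$. An algebra has the congruence extension property if for every subalgebra $B$ and every congruence $\Theta$ of $B$ there is a congruence $\Psi$ of the algebra with $\Psi\cap(B\times B)=\Theta$. -}

module Defs where

open import Level using (Level; _⊔_; suc)
open import Data.Product using (Σ; _,_; proj₁; _×_; ∃)
open import Relation.Binary.Core using (Rel; _⇒_)
open import Relation.Binary.Structures using (IsEquivalence)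
open import Algebra.Lattice.Bundles using (BooleanAlgebra)

record BooleanFrame (c ℓ : Level) : Set (suc (c ⊔ ℓ)) where
  field
    boolAlg : BooleanAlgebra c ℓ
  open BooleanAlgebra boolAlg public
  field
    f      : Carrier → Carrier
    f-cong : ∀ {x y} → x ≈ y → f x ≈ f y

module _ {c ℓ : Level} (𝔄 : BooleanFrame c ℓ) where
  open BooleanFrame 𝔄

  Additive : Set (c ⊔ ℓ)
  Additive = ∀ x y → f (x ∨ y) ≈ f x ∨ f y

  Normal : Set ℓ
  Normal = f ⊥ ≈ ⊥

  -- A subuniverse (carrier of a subalgebra) of ⟨A, ⊓, -, 0, f⟩:
  -- a subset closed under the operations; since elements of the algebra are
  -- _≈_-classes, the subset is required to be closed under _≈_.
  record IsSubuniverse {p : Level} (P : Carrier → Set p) : Set (c ⊔ ℓ ⊔ p) where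
    field
      resp  : ∀ {x y} → x ≈ y → P x → P y
      ⊓-cl  : ∀ {x y} → P x → P y → P (x ∧ y)
      neg-cl : ∀ {x} → P x → P (¬ x)
      0-cl  : P ⊥
      f-cl  : ∀ {x} → P x → P (f x)

  -- Congruence of 𝔄: an equivalence relation (coarser than _≈_) compatible
  -- with ⊓, -, f (compatibility with the constant 0 is automatic).
  record IsCongruence {t : Level} (Ψ : Rel Carrier t) : Set (c ⊔ ℓ ⊔ t) where
    field
      isEquivalence : IsEquivalence Ψ
      ≈⊆            : _≈_ ⇒ Ψ
      ⊓-compat      : ∀ {x x′ y y′} → Ψ x x′ → Ψ y y′ → Ψ (x ∧ y) (x′ ∧ y′)
      neg-compat    : ∀ {x x′} → Ψ x x′ → Ψ (¬ x) (¬ x′)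
      f-compat      : ∀ {x x′} → Ψ x x′ → Ψ (f x) (f x′)

  Sub : {p : Level} → (Carrier → Set p) → Set (c ⊔ p)
  Sub P = Σ Carrier P

  record IsSubCongruence {p t : Level} {P : Carrier → Set p}
                         (S : IsSubuniverse P) (Θ : Rel (Sub P) t)
                         : Set (c ⊔ ℓ ⊔ p ⊔ t) where
    open IsSubuniverse S
    field
      isEquivalence : IsEquivalence Θ
      ≈⊆            : ∀ {b b′ : Sub P} → proj₁ b ≈ proj₁ b′ → Θ b b′
      ⊓-compat      : ∀ {x x′ y y′ : Carrier}
                        {px : P x} {px′ : P x′} {py : P y} {py′ : P y′} →
                        Θ (x , px) (x′ , px′) → Θ (y , py) (y′ , py′) →
                        Θ (x ∧ y , ⊓-cl px py) (x′ ∧ y′ , ⊓-cl px′ py′)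
      neg-compat    : ∀ {x x′ : Carrier} {px : P x} {px′ : P x′} →
                        Θ (x , px) (x′ , px′) → Θ (¬ x , neg-cl px) (¬ x′ , neg-cl px′)
      f-compat      : ∀ {x x′ : Carrier} {px : P x} {px′ : P x′} →
                        Θ (x , px) (x′ , px′) → Θ (f x , f-cl px) (f x′ , f-cl px′)

  CEP : (p t : Level) → Set (suc (c ⊔ ℓ ⊔ p ⊔ t))
  CEP p t =
    ∀ (P : Carrier → Set p) (S : IsSubuniverse P) (Θ : Rel (Sub P) t) →
    IsSubCongruence S Θ →
    Σ (Rel Carrier (c ⊔ ℓ ⊔ p ⊔ t)) λ Ψ →
      IsCongruence Ψ ×
      (∀ (b b′ : Sub P) → (Ψ (proj₁ b) (proj₁ b′) → Θ b b′)
                         × (Θ b b′ → Ψ (proj₁ b) (proj₁ b′)))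

{-# OPTIONS --safe #-}
-- A congruence of a Boolean algebra is determined by its kernel ideal:
-- x Ψ y iff x ∨ j ≈ y ∨ j for some j in the ideal. Take for the ideal the
-- elements of the subalgebra that are Θ-congruent to 0. Such a Ψ respects ⊓
-- and ¬, and it restricts to Θ because x Θ y iff x ⊕ y Θ 0. As for f,
-- additivity makes f monotone, so f ⊥ ≤ f x and f (x ∨ j) ≈ f x ∨ (f j ∧ ¬ f ⊥);
-- since j Θ 0 gives f j ∧ ¬ f ⊥ Θ f ⊥ ∧ ¬ f ⊥ ≈ ⊥, the ideal is closed under
-- j ↦ f j ∧ ¬ f ⊥, and this replaces normality.
module Submission where

open import Defs
open import Level using (Level; _⊔_)
open import Data.Product using (Σ; _,_; proj₁; _×_)
open import Relation.Binary.Core using (Rel)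
open import Relation.Binary.Structures using (IsEquivalence)
open import Relation.Binary.Bundles using (Setoid)
open import Algebra.Lattice.Bundles using (BooleanAlgebra)

module Modulo {c ℓ : Level} (B : BooleanAlgebra c ℓ) where
  open BooleanAlgebra B
  open import Algebra.Lattice.Properties.BooleanAlgebra B
  open DefaultXorRing using (⊕-comm)
  open import Relation.Binary.Reasoning.Setoid setoid

  ¬[¬x∧¬y]≈x∨y : ∀ x y → ¬ (¬ x ∧ ¬ y) ≈ x ∨ y
  ¬[¬x∧¬y]≈x∨y x y = trans (deMorgan₁ (¬ x) (¬ y)) (∨-cong (¬-involutive x) (¬-involutive y))

  infix 4 _≈_mod_
  _≈_mod_ : Carrier → Carrier → Carrier → Set ℓ
  x ≈ y mod j = x ∨ j ≈ y ∨ j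

  mod-weakenʳ : ∀ {x y j} k → x ≈ y mod j → x ≈ y mod j ∨ k
  mod-weakenʳ {x} {y} {j} k e = begin
    x ∨ (j ∨ k)  ≈⟨ ∨-assoc x j k ⟨
    (x ∨ j) ∨ k  ≈⟨ ∨-congʳ e ⟩
    (y ∨ j) ∨ k  ≈⟨ ∨-assoc y j k ⟩
    y ∨ (j ∨ k)  ∎

  mod-weakenˡ : ∀ {x y k} j → x ≈ y mod k → x ≈ y mod j ∨ k
  mod-weakenˡ {x} {y} {k} j e = begin
    x ∨ (j ∨ k)  ≈⟨ ∨-congˡ (∨-comm j k) ⟩
    x ∨ (k ∨ j)  ≈⟨ mod-weakenʳ j e ⟩
    y ∨ (k ∨ j)  ≈⟨ ∨-congˡ (∨-comm k j) ⟩
    y ∨ (j ∨ k)  ∎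

  mod-∧ : ∀ {x x′ y y′ j} → x ≈ x′ mod j → y ≈ y′ mod j → x ∧ y ≈ x′ ∧ y′ mod j
  mod-∧ {x} {x′} {y} {y′} {j} e e′ = begin
    (x ∧ y) ∨ j          ≈⟨ ∨-distribʳ-∧ j x y ⟩
    (x ∨ j) ∧ (y ∨ j)    ≈⟨ ∧-cong e e′ ⟩
    (x′ ∨ j) ∧ (y′ ∨ j)  ≈⟨ ∨-distribʳ-∧ j x′ y′ ⟨
    (x′ ∧ y′) ∨ j        ∎

  mod-¬ : ∀ {x x′ j} → x ≈ x′ mod j → ¬ x ≈ ¬ x′ mod j
  mod-¬ {x} {x′} {j} e = begin
    ¬ x ∨ j               ≈⟨ ¬z∨j≈¬[[z∨j]∧¬j] x ⟩
    ¬ ((x ∨ j) ∧ ¬ j)     ≈⟨ ¬-cong (∧-congʳ e) ⟩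
    ¬ ((x′ ∨ j) ∧ ¬ j)    ≈⟨ ¬z∨j≈¬[[z∨j]∧¬j] x′ ⟨
    ¬ x′ ∨ j              ∎
    where
    ¬z∨j≈¬[[z∨j]∧¬j] : ∀ z → ¬ z ∨ j ≈ ¬ ((z ∨ j) ∧ ¬ j)
    ¬z∨j≈¬[[z∨j]∧¬j] z = begin
      ¬ z ∨ j                  ≈⟨ ∨-congˡ (¬-involutive j) ⟨
      ¬ z ∨ ¬ ¬ j              ≈⟨ deMorgan₁ z (¬ j) ⟨
      ¬ (z ∧ ¬ j)              ≈⟨ ¬-cong (∨-identityʳ (z ∧ ¬ j)) ⟨
      ¬ (z ∧ ¬ j ∨ ⊥)          ≈⟨ ¬-cong (∨-congˡ (∧-complementʳ j)) ⟨
      ¬ (z ∧ ¬ j ∨ j ∧ ¬ j)    ≈⟨ ¬-cong (∧-distribʳ-∨ (¬ j) z j) ⟨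
      ¬ ((z ∨ j) ∧ ¬ j)        ∎

  x∨[x⊕y]≈x∨y : ∀ x y → x ∨ (x ⊕ y) ≈ x ∨ y
  x∨[x⊕y]≈x∨y x y = begin
    x ∨ ((x ∨ y) ∧ ¬ (x ∧ y))          ≈⟨ ∨-distribˡ-∧ x (x ∨ y) (¬ (x ∧ y)) ⟩
    (x ∨ (x ∨ y)) ∧ (x ∨ ¬ (x ∧ y))    ≈⟨ ∧-cong x∨[x∨y]≈x∨y x∨¬[x∧y]≈⊤ ⟩
    (x ∨ y) ∧ ⊤                        ≈⟨ ∧-identityʳ (x ∨ y) ⟩
    x ∨ y                              ∎
    where
    x∨[x∨y]≈x∨y : x ∨ (x ∨ y) ≈ x ∨ y
    x∨[x∨y]≈x∨y = trans (sym (∨-assoc x x y)) (∨-congʳ (∨-idem x))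
    x∨¬[x∧y]≈⊤ : x ∨ ¬ (x ∧ y) ≈ ⊤
    x∨¬[x∧y]≈⊤ = begin
      x ∨ ¬ (x ∧ y)      ≈⟨ ∨-congˡ (deMorgan₁ x y) ⟩
      x ∨ (¬ x ∨ ¬ y)    ≈⟨ ∨-assoc x (¬ x) (¬ y) ⟨
      (x ∨ ¬ x) ∨ ¬ y    ≈⟨ ∨-congʳ (∨-complementʳ x) ⟩
      ⊤ ∨ ¬ y            ≈⟨ ∨-zeroˡ (¬ y) ⟩
      ⊤                  ∎

  mod-⊕ : ∀ x y → x ≈ y mod x ⊕ y
  mod-⊕ x y = begin
    x ∨ (x ⊕ y)  ≈⟨ x∨[x⊕y]≈x∨y x y ⟩
    x ∨ y        ≈⟨ ∨-comm x y ⟩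
    y ∨ x        ≈⟨ x∨[x⊕y]≈x∨y y x ⟨
    y ∨ (y ⊕ x)  ≈⟨ ∨-congˡ (⊕-comm y x) ⟩
    y ∨ (x ⊕ y)  ∎

module AdditiveFrame {c ℓ : Level} (𝔄 : BooleanFrame c ℓ) (add : Additive 𝔄) where
  open BooleanFrame 𝔄
  open import Algebra.Lattice.Properties.BooleanAlgebra boolAlg
  open Modulo boolAlg
  open import Relation.Binary.Reasoning.Setoid setoid

  fx∨f⊥≈fx : ∀ x → f x ∨ f ⊥ ≈ f x
  fx∨f⊥≈fx x = trans (sym (add x ⊥)) (f-cong (∨-identityʳ x))

  fx∨¬f⊥≈⊤ : ∀ x → f x ∨ ¬ f ⊥ ≈ ⊤
  fx∨¬f⊥≈⊤ x = begin
    f x ∨ ¬ f ⊥             ≈⟨ ∨-congʳ (fx∨f⊥≈fx x) ⟨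
    (f x ∨ f ⊥) ∨ ¬ f ⊥     ≈⟨ ∨-assoc (f x) (f ⊥) (¬ f ⊥) ⟩
    f x ∨ (f ⊥ ∨ ¬ f ⊥)     ≈⟨ ∨-congˡ (∨-complementʳ (f ⊥)) ⟩
    f x ∨ ⊤                 ≈⟨ ∨-zeroʳ (f x) ⟩
    ⊤                       ∎

  fx∨[fj∧¬f⊥]≈f[x∨j] : ∀ x j → f x ∨ (f j ∧ ¬ f ⊥) ≈ f (x ∨ j)
  fx∨[fj∧¬f⊥]≈f[x∨j] x j = begin
    f x ∨ (f j ∧ ¬ f ⊥)           ≈⟨ ∨-distribˡ-∧ (f x) (f j) (¬ f ⊥) ⟩
    (f x ∨ f j) ∧ (f x ∨ ¬ f ⊥)   ≈⟨ ∧-cong (sym (add x j)) (fx∨¬f⊥≈⊤ x) ⟩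
    f (x ∨ j) ∧ ⊤                 ≈⟨ ∧-identityʳ (f (x ∨ j)) ⟩
    f (x ∨ j)                     ∎

  mod-f : ∀ {x x′ j} → x ≈ x′ mod j → f x ≈ f x′ mod f j ∧ ¬ f ⊥
  mod-f {x} {x′} {j} e = begin
    f x ∨ (f j ∧ ¬ f ⊥)    ≈⟨ fx∨[fj∧¬f⊥]≈f[x∨j] x j ⟩
    f (x ∨ j)              ≈⟨ f-cong e ⟩
    f (x′ ∨ j)             ≈⟨ fx∨[fj∧¬f⊥]≈f[x∨j] x′ j ⟨
    f x′ ∨ (f j ∧ ¬ f ⊥)   ∎

module Subuniverse {c ℓ p : Level} {𝔄 : BooleanFrame c ℓ} {P : BooleanFrame.Carrier 𝔄 → Set p}
                   (S : IsSubuniverse 𝔄 P) where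
  open BooleanFrame 𝔄
  open import Algebra.Lattice.Properties.BooleanAlgebra boolAlg
  open IsSubuniverse S
  open Modulo boolAlg using (¬[¬x∧¬y]≈x∨y)

  ∨-cl : ∀ {x y} → P x → P y → P (x ∨ y)
  ∨-cl {x} {y} px py = resp (¬[¬x∧¬y]≈x∨y x y) (neg-cl (⊓-cl (neg-cl px) (neg-cl py)))

  ⊕-cl : ∀ {x y} → P x → P y → P (x ⊕ y)
  ⊕-cl px py = ⊓-cl (∨-cl px py) (neg-cl (⊓-cl px py))

module SubCongruence {c ℓ p t : Level} {𝔄 : BooleanFrame c ℓ} {P : BooleanFrame.Carrier 𝔄 → Set p}
                     {S : IsSubuniverse 𝔄 P} {Θ : Rel (Sub 𝔄 P) t}
                     (ΘC : IsSubCongruence 𝔄 S Θ) where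
  open BooleanFrame 𝔄
  open import Algebra.Lattice.Properties.BooleanAlgebra boolAlg
  open DefaultXorRing using (⊕-inverseʳ)
  open Modulo boolAlg using (_≈_mod_; ¬[¬x∧¬y]≈x∨y)
  open IsSubuniverse S
  open Subuniverse S
  open IsSubCongruence ΘC hiding (isEquivalence)
  open IsEquivalence (IsSubCongruence.isEquivalence ΘC)
    renaming (refl to Θ-refl; sym to Θ-sym; trans to Θ-trans)

  Θ-∨ : ∀ {x x′ y y′} {px : P x} {px′ : P x′} {py : P y} {py′ : P y′} →
        Θ (x , px) (x′ , px′) → Θ (y , py) (y′ , py′) →
        Θ (x ∨ y , ∨-cl px py) (x′ ∨ y′ , ∨-cl px′ py′)
  Θ-∨ {x} {x′} {y} {y′} θx θy =
    Θ-trans (≈⊆ (sym (¬[¬x∧¬y]≈x∨y x y)))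
      (Θ-trans (neg-compat (⊓-compat (neg-compat θx) (neg-compat θy)))
               (≈⊆ (¬[¬x∧¬y]≈x∨y x′ y′)))

  Θ-⊕ : ∀ {x x′ y y′} {px : P x} {px′ : P x′} {py : P y} {py′ : P y′} →
        Θ (x , px) (x′ , px′) → Θ (y , py) (y′ , py′) →
        Θ (x ⊕ y , ⊕-cl px py) (x′ ⊕ y′ , ⊕-cl px′ py′)
  Θ-⊕ θx θy = ⊓-compat (Θ-∨ θx θy) (neg-compat (⊓-compat θx θy))

  Θ-setoid : Setoid (c ⊔ p) t
  Θ-setoid = record { isEquivalence = IsSubCongruence.isEquivalence ΘC }

  Kernel : Carrier → Set (p ⊔ t)
  Kernel j = Σ (P j) λ pj → Θ (j , pj) (⊥ , 0-cl)

  kernel-⊥ : Kernel ⊥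
  kernel-⊥ = 0-cl , Θ-refl

  kernel-∨ : ∀ {j k} → Kernel j → Kernel k → Kernel (j ∨ k)
  kernel-∨ (pj , θj) (pk , θk) = ∨-cl pj pk , Θ-trans (Θ-∨ θj θk) (≈⊆ (∨-idem ⊥))

  kernel-⊕ : ∀ {x y} {px : P x} {py : P y} → Θ (x , px) (y , py) → Kernel (x ⊕ y)
  kernel-⊕ {x} {px = px} {py} θ =
    ⊕-cl px py , Θ-trans (Θ-⊕ (Θ-refl {x , px}) (Θ-sym θ)) (≈⊆ (⊕-inverseʳ x))

  kernel-f∖f⊥ : ∀ {j} → Kernel j → Kernel (f j ∧ ¬ f ⊥)
  kernel-f∖f⊥ (pj , θj) =
    ⊓-cl (f-cl pj) ¬f⊥-cl ,
    Θ-trans (⊓-compat (f-compat θj) (Θ-refl {¬ f ⊥ , ¬f⊥-cl})) (≈⊆ (∧-complementʳ (f ⊥)))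
    where
    ¬f⊥-cl : P (¬ f ⊥)
    ¬f⊥-cl = neg-cl (f-cl 0-cl)

  Θ-mod : ∀ {x y j} {px : P x} {py : P y} → Kernel j → x ≈ y mod j → Θ (x , px) (y , py)
  Θ-mod {x} {y} {j} {px} {py} (pj , θj) e = begin
    (x , px)                ≈⟨ ≈⊆ (∨-identityʳ x) ⟨
    (x ∨ ⊥ , ∨-cl px 0-cl)  ≈⟨ Θ-∨ Θ-refl θj ⟨
    (x ∨ j , ∨-cl px pj)    ≈⟨ ≈⊆ e ⟩
    (y ∨ j , ∨-cl py pj)    ≈⟨ Θ-∨ Θ-refl θj ⟩
    (y ∨ ⊥ , ∨-cl py 0-cl)  ≈⟨ ≈⊆ (∨-identityʳ y) ⟩
    (y , py)                ∎
    where open import Relation.Binary.Reasoning.Setoid Θ-setoid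

module CongruenceExtension {c ℓ p t : Level} {𝔄 : BooleanFrame c ℓ} (add : Additive 𝔄)
                           {P : BooleanFrame.Carrier 𝔄 → Set p} {S : IsSubuniverse 𝔄 P}
                           {Θ : Rel (Sub 𝔄 P) t} (ΘC : IsSubCongruence 𝔄 S Θ) where
  open BooleanFrame 𝔄
  open import Algebra.Lattice.Properties.BooleanAlgebra boolAlg using (_⊕_)
  open Modulo boolAlg
  open AdditiveFrame 𝔄 add
  open SubCongruence ΘC

  Ψ : Rel Carrier (c ⊔ ℓ ⊔ p ⊔ t)
  Ψ x y = Σ Carrier λ j → Kernel j × x ≈ y mod j

  Ψ-isCongruence : IsCongruence 𝔄 Ψ
  Ψ-isCongruence = record
    { isEquivalence = record
      { refl  = ⊥ , kernel-⊥ , refl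
      ; sym   = λ { (j , kj , e) → j , kj , sym e }
      ; trans = λ { (j , kj , e) (k , kk , e′) →
          j ∨ k , kernel-∨ kj kk , trans (mod-weakenʳ k e) (mod-weakenˡ j e′) }
      }
    ; ≈⊆         = λ e → ⊥ , kernel-⊥ , ∨-congʳ e
    ; ⊓-compat   = λ { (j , kj , e) (k , kk , e′) →
          j ∨ k , kernel-∨ kj kk , mod-∧ (mod-weakenʳ k e) (mod-weakenˡ j e′) }
    ; neg-compat = λ { (j , kj , e) → j , kj , mod-¬ e }
    ; f-compat   = λ { (j , kj , e) → f j ∧ ¬ f ⊥ , kernel-f∖f⊥ kj , mod-f e }
    }

  Ψ-restricts-to-Θ : ∀ (b b′ : Sub 𝔄 P) → (Ψ (proj₁ b) (proj₁ b′) → Θ b b′)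
                                         × (Θ b b′ → Ψ (proj₁ b) (proj₁ b′))
  Ψ-restricts-to-Θ (x , _) (y , _) =
    (λ { (j , kj , e) → Θ-mod kj e }) ,
    (λ θ → x ⊕ y , kernel-⊕ θ , mod-⊕ x y)

proposition2p24 : {c ℓ p t : Level} (𝔄 : BooleanFrame c ℓ) →
                  Additive 𝔄 → CEP 𝔄 p t
proposition2p24 𝔄 add P S Θ ΘC = Ψ , Ψ-isCongruence , Ψ-restricts-to-Θ
  where open CongruenceExtension add ΘC
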